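{- For every $n\in\mathbb{F}$ and $t\in\Lambda(n)$, exactly one of the following holds: (1) $\gamma_2(t)\in\Lambda(n)$ and $t\to\gamma_2(t)$; (2) $\gamma_2(t)\in\Lambda^\Lambda(n)$, $t=\lambda x.t'$ for some $t'$, and $\gamma_2(t)(e)=t'[e/x]$ for every $e\in\Lambda(n)$; (3) $\gamma_2(t)=*$ and $t=x\,s_1\cdots s_k$ for some variable $x\in n$, some $k\ge0$ and terms $s_1,\dots,s_k\in\Lambda(n)$.
   Context: $\mathbb{F}$ is the category of finite cardinals $n=\{0,\dots,n-1\}$ and all functions. $\Lambda(n)$ is the set of untyped $\lambda$-terms modulo $\alpha$-equivalence with free variables among $0,\dots,n-1$; for $t'\in\Lambda(n+1)$, $\lambda.t'=\lambda x.t'\in\Lambda(n)$ binds $x=n$; application associates to the left. $\to$ is the call-by-name small-step reduction: if $p\to p'$ then $p\,q\to p'\,q$; and $(\lambda x.p)\,q\to p[q/x]$ (capture-avoiding substitution). For $\vec u\in\Lambda(m)^n$, $\mathrm{up}(\vec u)\in\Lambda(m+1)^n$ weakens each term along $m\hookrightarrow m+1$. $\langle\!\langle\Lambda,\Lambda\rangle\!\rangle(n)=\mathrm{Nat}(\Lambda^n,\Lambda)$; $\Lambda^\Lambda(n)=\mathrm{Nat}(\mathbb{F}(n,-)\times\Lambda,\Lambda)$ with $f(e):=f_n(\mathrm{id}_n,e)$. The operational model of the call-by-name higher-order GSOS law is $\langle\gamma_1,\gamma_2\rangle\colon\Lambda\to\langle\!\langle\Lambda,\Lambda\rangle\!\rangle\times(\Lambda+\Lambda^\Lambda+1)$,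 explicitly the unique family satisfying, for $\vec u\in\Lambda(m)^n$: for a variable $v\in n$, $\gamma_1(v)(\vec u)=u_v$, $\gamma_2(v)=*$; for $t'\in\Lambda(n+1)$, $\gamma_1(\lambda.t')(\vec u)=\lambda.(\gamma_1(t')(\mathrm{up}(\vec u),m))$ and $\gamma_2(\lambda.t')\in\Lambda^\Lambda(n)$ is $(r,e)\in\mathbb{F}(n,k)\times\Lambda(k)\mapsto\gamma_1(t')(r(0),\dots,r(n-1),e)$; $\gamma_1(t_1\,t_2)(\vec u)=\gamma_1(t_1)(\vec u)\,\gamma_1(t_2)(\vec u)$, and $\gamma_2(t_1\,t_2)$ equals $\gamma_2(t_1)\,t_2$ if $\gamma_2(t_1)\in\Lambda(n)$, $\gamma_2(t_1)(t_2)$ if $\gamma_2(t_1)\in\Lambda^\Lambda(n)$, and $*$ if $\gamma_2(t_1)=*$. -}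

module Defs where

open import Data.Nat using (ℕ; zero; suc)
open import Data.Fin using (Fin; zero; suc; fromℕ; inject₁)
open import Data.List using (List; foldl)
open import Data.Product using (Σ; _×_)
open import Data.Sum using (_⊎_)
open import Relation.Nullary using (¬_)
open import Relation.Binary.PropositionalEquality using (_≡_)
open import Function using (_∘_; id)

-- Λ(n): λ-terms with free variables among 0..n-1 (nameless, so α-equivalence
-- is syntactic equality).  `lam t'` with t' : Λ (suc n) binds the variable n,
-- i.e. the LAST element `fromℕ n` of Fin (suc n).
data Λ (n : ℕ) : Set where
  var : Fin n → Λ n
  lam : Λ (suc n) → Λ n
  app : Λ n → Λ n → Λ n

snoc : {A : Set} {n : ℕ} → (Fin n → A) → A → Fin (suc n) → A
snoc {n = zero}  f a zero    = a
snoc {n = suc n} f a zero    = f zero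
snoc {n = suc n} f a (suc i) = snoc (f ∘ suc) a i

ren : {n m : ℕ} → (Fin n → Fin m) → Λ n → Λ m
ren ρ (var v)   = var (ρ v)
ren {m = m} ρ (lam t) = lam (ren (snoc (inject₁ ∘ ρ) (fromℕ m)) t)
ren ρ (app s t) = app (ren ρ s) (ren ρ t)

sub : {n m : ℕ} → (Fin n → Λ m) → Λ n → Λ m
sub σ (var v)   = σ v
sub {m = m} σ (lam t) = lam (sub (snoc (ren inject₁ ∘ σ) (var (fromℕ m))) t)
sub σ (app s t) = app (sub σ s) (sub σ t)

infix 8 _[_]
_[_] : {n : ℕ} → Λ (suc n) → Λ n → Λ n
p [ q ] = sub (snoc var q) p

infix 4 _⟶_
data _⟶_ {n : ℕ} : Λ n → Λ n → Set where
  appL : {p p' q : Λ n} → p ⟶ p' → app p q ⟶ app p' q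
  beta : {p : Λ (suc n)} {q : Λ n} → app (lam p) q ⟶ p [ q ]

up : {n m : ℕ} → (Fin n → Λ m) → Fin n → Λ (suc m)
up u = ren inject₁ ∘ u

-- γ₁ : Λ → ⟨⟨Λ,Λ⟩⟩, with ⟨⟨Λ,Λ⟩⟩(n)(m) = Λ(m)^n → Λ(m)
γ₁ : {n : ℕ} → Λ n → {m : ℕ} → (Fin n → Λ m) → Λ m
γ₁ (var v)     u = u v
γ₁ (lam t') {m} u = lam (γ₁ t' (snoc (up u) (var (fromℕ m))))
γ₁ (app t₁ t₂) u = app (γ₁ t₁ u) (γ₁ t₂ u)

-- Λ^Λ(n): families f_k : 𝔽(n,k) × Λ(k) → Λ(k)  (naturality not recorded)
ΛΛ : ℕ → Set
ΛΛ n = {k : ℕ} → (Fin n → Fin k) → Λ k → Λ k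

_·_ : {n : ℕ} → ΛΛ n → Λ n → Λ n
f · e = f id e

data Beh (n : ℕ) : Set where
  red   : Λ n → Beh n
  fun   : ΛΛ n → Beh n
  stuck : Beh n

appBeh : {n : ℕ} → Beh n → Λ n → Beh n
appBeh (red s) t₂ = red (app s t₂)
appBeh (fun f) t₂ = red (f · t₂)
appBeh stuck   t₂ = stuck

γ₂ : {n : ℕ} → Λ n → Beh n
γ₂ (var v)     = stuck
γ₂ (lam t')    = fun (λ r e → γ₁ t' (snoc (var ∘ r) e))
γ₂ (app t₁ t₂) = appBeh (γ₂ t₁) t₂

Case1 : {n : ℕ} → Λ n → Set
Case1 {n} t = Σ (Λ n) λ s → (γ₂ t ≡ red s) × (t ⟶ s)

Case2 : {n : ℕ} → Λ n → Set
Case2 {n} t = Σ (ΛΛ n) λ f → (γ₂ t ≡ fun f) ×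
  Σ (Λ (suc n)) λ t' → (t ≡ lam t') × ((e : Λ n) → f · e ≡ t' [ e ])

-- t = x s₁ ⋯ s_k  (k = length of the list, possibly 0)
Case3 : {n : ℕ} → Λ n → Set
Case3 {n} t = (γ₂ t ≡ stuck) ×
  Σ (Fin n) λ x → Σ (List (Λ n)) λ ss → t ≡ foldl app (var x) ss

ExactlyOne3 : Set → Set → Set → Set
ExactlyOne3 A B C = (A ⊎ (B ⊎ C)) × (¬ (A × B) × (¬ (A × C) × ¬ (B × C)))

module Submission where

open import Data.Nat using (ℕ; suc)
open import Data.Fin using (Fin)
open import Data.List using (List; []; foldl; _∷ʳ_)
open import Data.List.Properties using (foldl-∷ʳ)
open import Data.Product using (_×_; _,_)
open import Data.Sum using (_⊎_; inj₁; inj₂)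
open import Relation.Nullary using (¬_)
open import Relation.Binary.PropositionalEquality
  using (_≡_; refl; sym; trans; cong; cong₂)
open import Defs

-- Induction along the head of the application spine: a reducible head or a
-- β-redex reduces, a variable head is stuck, and a λ behaves as a function
-- because γ₁ is just parallel substitution.  The cases exclude each other since
-- each one fixes the constructor of γ₂ t.

γ₁≡sub : ∀ {n m} (t : Λ n) (u : Fin n → Λ m) → γ₁ t u ≡ sub u t
γ₁≡sub (var v)   u = refl
γ₁≡sub (lam t)   u = cong lam (γ₁≡sub t _)
γ₁≡sub (app s t) u = cong₂ app (γ₁≡sub s u) (γ₁≡sub t u)

γ₂-app : ∀ {n} (t₁ t₂ : Λ n) {b : Beh n} →
         γ₂ t₁ ≡ b → γ₂ (app t₁ t₂) ≡ appBeh b t₂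
γ₂-app t₁ t₂ = cong (λ b → appBeh b t₂)

Case1-appL : ∀ {n} {t₁ : Λ n} (t₂ : Λ n) → Case1 t₁ → Case1 (app t₁ t₂)
Case1-appL {t₁ = t₁} t₂ (s , γ₂≡ , t₁⟶s) = app s t₂ , γ₂-app t₁ t₂ γ₂≡ , appL t₁⟶s

Case2⇒Case1-app : ∀ {n} {t₁ : Λ n} (t₂ : Λ n) → Case2 t₁ → Case1 (app t₁ t₂)
Case2⇒Case1-app {t₁ = t₁} t₂ (f , γ₂≡ , t' , refl , f·≡) =
  t' [ t₂ ] , trans (γ₂-app t₁ t₂ γ₂≡) (cong red (f·≡ t₂)) , beta

Case3-app : ∀ {n} {t₁ : Λ n} (t₂ : Λ n) → Case3 t₁ → Case3 (app t₁ t₂)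
Case3-app {t₁ = t₁} t₂ (γ₂≡ , x , ss , refl) =
  γ₂-app t₁ t₂ γ₂≡ , x , ss ∷ʳ t₂ , sym (foldl-∷ʳ app (var x) t₂ ss)

Case2-lam : ∀ {n} (t' : Λ (suc n)) → Case2 (lam t')
Case2-lam t' = _ , refl , t' , refl , λ e → γ₁≡sub t' (snoc var e)

classify : ∀ {n} (t : Λ n) → Case1 t ⊎ (Case2 t ⊎ Case3 t)
classify (var x)     = inj₂ (inj₂ (refl , x , [] , refl))
classify (lam t')    = inj₂ (inj₁ (Case2-lam t'))
classify (app t₁ t₂) with classify t₁
... | inj₁ c₁        = inj₁ (Case1-appL t₂ c₁)
... | inj₂ (inj₁ c₂) = inj₁ (Case2⇒Case1-app t₂ c₂)
... | inj₂ (inj₂ c₃) = inj₂ (inj₂ (Case3-app t₂ c₃))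

module _ {n : ℕ} {t : Λ n} where

  ¬Case1×Case2 : ¬ (Case1 t × Case2 t)
  ¬Case1×Case2 ((_ , red≡ , _) , (_ , fun≡ , _)) with trans (sym red≡) fun≡
  ... | ()

  ¬Case1×Case3 : ¬ (Case1 t × Case3 t)
  ¬Case1×Case3 ((_ , red≡ , _) , (stuck≡ , _)) with trans (sym red≡) stuck≡
  ... | ()

  ¬Case2×Case3 : ¬ (Case2 t × Case3 t)
  ¬Case2×Case3 ((_ , fun≡ , _) , (stuck≡ , _)) with trans (sym fun≡) stuck≡
  ... | ()

proposition5p10 : (n : ℕ) (t : Λ n) → ExactlyOne3 (Case1 t) (Case2 t) (Case3 t)
proposition5p10 n t = classify t , ¬Case1×Case2 , ¬Case1×Case3 , ¬Case2×Case3
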